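{- Let $T$ be a perfect binary tree of height at least $2$ and let $f$ be an independent broadcast on $T$ of maximum weight. If $l$ is a leaf of $T$ with $f(l) > 0$, then $f(l) = 3$.
   Context: For a graph $G$, $d(u,v)$ is the distance, $\mathrm{ecc}(v)$ the eccentricity, $\mathrm{diam}(G)$ the diameter. A broadcast on $G$ is a function $f: V(G)\to\{0,\dots,\mathrm{diam}(G)\}$ with $f(v)\le\mathrm{ecc}(v)$; its weight is $\sum_v f(v)$. A vertex $v$ is broadcasting if $f(v)>0$; $u$ hears a broadcasting $v$ if $d(u,v)\le f(v)$. A broadcast is independent if every broadcasting vertex hears only itself. A perfect binary tree of height $h$ is the rooted tree in which every non-leaf vertex has exactly $2$ children and all leaves are at distance $h$ from the root. -}

module Defs where

open import Data.Nat using (ℕ; zero; suc; _+_; _≤_; _<_; _⊔_)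
open import Data.List using (List; []; _∷_; _++_; map; foldr)
open import Data.Nat.ListAction using (sum)
open import Relation.Binary.PropositionalEquality using (_≡_; _≢_)
open import Data.Product using (_×_)

-- Vertices of the perfect binary tree of height h.
-- Vtx 0 : just the root.  Vtx (suc h) : root, or a vertex of the left
-- subtree (height h), or a vertex of the right subtree (height h).
data Vtx : ℕ → Set where
  root : ∀ {h} → Vtx h
  L    : ∀ {h} → Vtx h → Vtx (suc h)
  R    : ∀ {h} → Vtx h → Vtx (suc h)

depth : ∀ {h} → Vtx h → ℕ
depth root  = 0
depth (L v) = suc (depth v)
depth (R v) = suc (depth v)

IsLeaf : ∀ {h} → Vtx h → Set
IsLeaf {h} v = depth v ≡ h

allV : (h : ℕ) → List (Vtx h)
allV zero    = root ∷ []
allV (suc h) = root ∷ (map L (allV h) ++ map R (allV h))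

dist : ∀ {h} → Vtx h → Vtx h → ℕ
dist root  v     = depth v
dist (L u) root  = depth (L u)
dist (R u) root  = depth (R u)
dist (L u) (L v) = dist u v
dist (R u) (R v) = dist u v
dist (L u) (R v) = depth (L u) + depth (R v)
dist (R u) (L v) = depth (R u) + depth (L v)

maxList : List ℕ → ℕ
maxList = foldr _⊔_ 0

ecc : ∀ {h} → Vtx h → ℕ
ecc {h} v = maxList (map (dist v) (allV h))

diam : ℕ → ℕ
diam h = maxList (map ecc (allV h))

-- a broadcast on T_h: f(v) ≤ ecc(v) (hence also f(v) ≤ diam)
IsBroadcast : ∀ {h} → (Vtx h → ℕ) → Set
IsBroadcast {h} f = ∀ v → (f v ≤ diam h) × (f v ≤ ecc v)

weight : ∀ {h} → (Vtx h → ℕ) → ℕ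
weight {h} f = sum (map f (allV h))

IsIndependent : ∀ {h} → (Vtx h → ℕ) → Set
IsIndependent f = ∀ u v → 0 < f u → 0 < f v → u ≢ v → f u < dist u v

IsIndepBroadcast : ∀ {h} → (Vtx h → ℕ) → Set
IsIndepBroadcast f = IsBroadcast f × IsIndependent f

IsMaxIndepBroadcast : ∀ {h} → (Vtx h → ℕ) → Set
IsMaxIndepBroadcast {h} f =
  IsIndepBroadcast f × (∀ (g : Vtx h → ℕ) → IsIndepBroadcast g → weight g ≤ weight f)

-- Let l be a broadcasting leaf of a maximum independent broadcast f, and T' the subtree of
-- height j having l as a leaf. Every vertex outside T' is equidistant from all leaves of T', so
-- f may be replaced on T' by any independent broadcast using only leaves of T' with a power
-- below the distance of each outside broadcaster to l, e.g. below f(l); by maximality, f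
-- already has at least the weight of the replacement on T'.
-- If f(l) ≥ 4, take 2j ∈ {f(l), f(l) - 1}: f vanishes on T' except at l, whereas two leaves
-- of T' at distance 2j can both broadcast with power 2j - 1, of total weight > f(l).
-- If f(l) ≤ 2, take j = 2 (when h = 2) or j = 3: a finite case analysis bounds the weight of
-- f on T' by 5, resp. 11, while every second leaf of T' can broadcast with power 3, of total
-- weight 6, resp. 12.
module Submission where

open import Defs
open import Data.Nat using (ℕ; zero; suc; _+_; _∸_; _≤_; _<_; _⊔_; z≤n; s≤s; pred; _≤?_)
open import Data.Nat.Properties
open import Data.Nat.Tactic.RingSolver using (solve-∀)
open import Data.List using ([]; _∷_; _++_; map)
open import Data.List.Properties using (map-++; map-∘)
open import Data.Nat.ListAction using (sum)
open import Data.Nat.ListAction.Properties using (sum-++)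
open import Data.Product using (_×_; _,_; proj₁; proj₂; map₁; Σ-syntax)
open import Data.Sum using (_⊎_; inj₁; inj₂)
open import Data.Empty using (⊥; ⊥-elim)
open import Function using (_∘_)
open import Relation.Nullary using (yes; no)
open import Relation.Binary.PropositionalEquality

zero⊎pos : ∀ n → n ≡ 0 ⊎ 0 < n
zero⊎pos zero    = inj₁ refl
zero⊎pos (suc n) = inj₂ (s≤s z≤n)

+-self-cancel-≤ : ∀ {m n} → m + m ≤ n + n → m ≤ n
+-self-cancel-≤ m+m≤n+n = ≮⇒≥ (λ n<m → <⇒≱ (+-mono-< n<m n<m) m+m≤n+n)

halve : ∀ m → Σ[ i ∈ ℕ ] (i + i ≤ m × m ≤ suc (i + i))
halve zero          = 0 , z≤n , z≤n
halve (suc zero)    = 0 , z≤n , ≤-refl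
halve (suc (suc m)) with halve m
... | i , lo , hi = suc i , s≤s (≤-trans (≤-reflexive (+-suc i i)) (s≤s lo))
                          , s≤s (s≤s (≤-trans hi (≤-reflexive (sym (+-suc i i)))))

L-injective : ∀ {h} {x y : Vtx h} → L x ≡ L y → x ≡ y
L-injective refl = refl

R-injective : ∀ {h} {x y : Vtx h} → R x ≡ R y → x ≡ y
R-injective refl = refl

weight-node : ∀ {h} (φ : Vtx (suc h) → ℕ) →
              weight φ ≡ φ root + (weight (φ ∘ L) + weight (φ ∘ R))
weight-node {h} φ = cong (φ root +_) (begin
    sum (map φ (map L vs ++ map R vs))
  ≡⟨ cong sum (map-++ φ (map L vs) (map R vs)) ⟩
    sum (map φ (map L vs) ++ map φ (map R vs))
  ≡⟨ sum-++ (map φ (map L vs)) (map φ (map R vs)) ⟩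
    sum (map φ (map L vs)) + sum (map φ (map R vs))
  ≡⟨ cong₂ _+_ (cong sum (sym (map-∘ vs))) (cong sum (sym (map-∘ vs))) ⟩
    weight (φ ∘ L) + weight (φ ∘ R) ∎)
  where open ≡-Reasoning
        vs = allV h

weight-zero : ∀ {h} (φ : Vtx h → ℕ) → (∀ x → φ x ≡ 0) → weight φ ≡ 0
weight-zero {zero} φ φ≡0 rewrite φ≡0 root = refl
weight-zero {suc h} φ φ≡0
  rewrite weight-node φ | φ≡0 root | weight-zero (φ ∘ L) (φ≡0 ∘ L) | weight-zero (φ ∘ R) (φ≡0 ∘ R) = refl

weight-supported : ∀ {h} (φ : Vtx h → ℕ) (a : Vtx h) → (∀ x → x ≢ a → φ x ≡ 0) → weight φ ≡ φ a
weight-supported {zero} φ root _ = +-identityʳ _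
weight-supported {suc h} φ root φ≡0
  rewrite weight-node φ | weight-zero (φ ∘ L) (λ x → φ≡0 (L x) λ ())
        | weight-zero (φ ∘ R) (λ x → φ≡0 (R x) λ ()) = +-identityʳ _
weight-supported {suc h} φ (L a) φ≡0
  rewrite weight-node φ | φ≡0 root (λ ()) | weight-zero (φ ∘ R) (λ x → φ≡0 (R x) λ ())
        | weight-supported (φ ∘ L) a (λ x x≢a → φ≡0 (L x) (x≢a ∘ L-injective)) = +-identityʳ _
weight-supported {suc h} φ (R a) φ≡0
  rewrite weight-node φ | φ≡0 root (λ ()) | weight-zero (φ ∘ L) (λ x → φ≡0 (L x) λ ())
        | weight-supported (φ ∘ R) a (λ x x≢a → φ≡0 (R x) (x≢a ∘ R-injective)) = refl

maxList-++ : ∀ xs ys → maxList (xs ++ ys) ≡ maxList xs ⊔ maxList ys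
maxList-++ []       ys = refl
maxList-++ (x ∷ xs) ys = trans (cong (x ⊔_) (maxList-++ xs ys)) (sym (⊔-assoc x _ _))

maxList-node : ∀ {h} (g : Vtx (suc h) → ℕ) →
               maxList (map g (allV (suc h)))
                 ≡ g root ⊔ (maxList (map (g ∘ L) (allV h)) ⊔ maxList (map (g ∘ R) (allV h)))
maxList-node {h} g = cong (g root ⊔_) (begin
    maxList (map g (map L vs ++ map R vs))
  ≡⟨ cong maxList (map-++ g (map L vs) (map R vs)) ⟩
    maxList (map g (map L vs) ++ map g (map R vs))
  ≡⟨ maxList-++ (map g (map L vs)) (map g (map R vs)) ⟩
    maxList (map g (map L vs)) ⊔ maxList (map g (map R vs))
  ≡⟨ cong₂ _⊔_ (cong maxList (sym (map-∘ vs))) (cong maxList (sym (map-∘ vs))) ⟩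
    maxList (map (g ∘ L) vs) ⊔ maxList (map (g ∘ R) vs) ∎)
  where open ≡-Reasoning
        vs = allV h

≤-maxList : ∀ {h} (g : Vtx h → ℕ) w → g w ≤ maxList (map g (allV h))
≤-maxList {zero}  g root = m≤m⊔n _ _
≤-maxList {suc h} g w rewrite maxList-node g with w
... | root = m≤m⊔n _ _
... | L w  = m≤n⇒m≤o⊔n (g root) (m≤n⇒m≤n⊔o _ (≤-maxList (g ∘ L) w))
... | R w  = m≤n⇒m≤o⊔n (g root) (m≤n⇒m≤o⊔n _ (≤-maxList (g ∘ R) w))

maxList-≤ : ∀ {h} (g : Vtx h → ℕ) {B} → (∀ w → g w ≤ B) → maxList (map g (allV h)) ≤ B
maxList-≤ {zero}  g g≤B = ⊔-lub (g≤B root) z≤n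
maxList-≤ {suc h} g g≤B rewrite maxList-node g =
  ⊔-lub (g≤B root) (⊔-lub (maxList-≤ (g ∘ L) (g≤B ∘ L)) (maxList-≤ (g ∘ R) (g≤B ∘ R)))

dist-≤-ecc : ∀ {h} (v w : Vtx h) → dist v w ≤ ecc v
dist-≤-ecc v = ≤-maxList (dist v)

ecc-≤-diam : ∀ {h} (v : Vtx h) → ecc v ≤ diam h
ecc-≤-diam = ≤-maxList ecc

depth-≤ : ∀ {h} (v : Vtx h) → depth v ≤ h
depth-≤ root  = z≤n
depth-≤ (L v) = s≤s (depth-≤ v)
depth-≤ (R v) = s≤s (depth-≤ v)

dist-≤-depth+depth : ∀ {h} (u v : Vtx h) → dist u v ≤ depth u + depth v
dist-≤-depth+depth root  v     = ≤-refl
dist-≤-depth+depth (L u) root  = m≤m+n _ _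
dist-≤-depth+depth (R u) root  = m≤m+n _ _
dist-≤-depth+depth (L u) (L v) = ≤-trans (dist-≤-depth+depth u v) (m≤n⇒m≤1+n (+-monoʳ-≤ (depth u) (n≤1+n _)))
dist-≤-depth+depth (R u) (R v) = ≤-trans (dist-≤-depth+depth u v) (m≤n⇒m≤1+n (+-monoʳ-≤ (depth u) (n≤1+n _)))
dist-≤-depth+depth (L u) (R v) = ≤-refl
dist-≤-depth+depth (R u) (L v) = ≤-refl

ecc-≤-height+height : ∀ {h} (v : Vtx h) → ecc v ≤ h + h
ecc-≤-height+height v =
  maxList-≤ (dist v) (λ w → ≤-trans (dist-≤-depth+depth v w) (+-mono-≤ (depth-≤ v) (depth-≤ w)))

depth+depth-≤-ecc : ∀ {h} (v : Vtx h) → depth v + depth v ≤ ecc v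
depth+depth-≤-ecc root  = z≤n
depth+depth-≤-ecc (L v) = dist-≤-ecc (L v) (R v)
depth+depth-≤-ecc (R v) = dist-≤-ecc (R v) (L v)

dist-sym : ∀ {h} (u v : Vtx h) → dist u v ≡ dist v u
dist-sym root  root  = refl
dist-sym root  (L v) = refl
dist-sym root  (R v) = refl
dist-sym (L u) root  = refl
dist-sym (R u) root  = refl
dist-sym (L u) (L v) = dist-sym u v
dist-sym (R u) (R v) = dist-sym u v
dist-sym (L u) (R v) = +-comm (suc (depth u)) (suc (depth v))
dist-sym (R u) (L v) = +-comm (suc (depth u)) (suc (depth v))

indep-bound : ∀ {h} {φ : Vtx h → ℕ} → IsIndependent φ →
              ∀ x {y} → 0 < φ y → x ≢ y → φ x ≤ pred (dist x y)
indep-bound {φ = φ} ind x {y} φy>0 x≢y with zero⊎pos (φ x)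
... | inj₁ φx≡0 = ≤-trans (≤-reflexive φx≡0) z≤n
... | inj₂ φx>0 = suc[m]≤n⇒m≤pred[n] (ind x y φx>0 φy>0 x≢y)

-- Subtrees and grafting

data Subtree (j : ℕ) : ℕ → Set where
  here : Subtree j j
  inL  : ∀ {h} → Subtree j h → Subtree j (suc h)
  inR  : ∀ {h} → Subtree j h → Subtree j (suc h)

emb : ∀ {j h} → Subtree j h → Vtx j → Vtx h
emb here    x = x
emb (inL c) x = L (emb c x)
emb (inR c) x = R (emb c x)

Outside : ∀ {j h} → Subtree j h → Vtx h → Set
Outside c u = ∀ x → u ≢ emb c x

emb-injective : ∀ {j h} (c : Subtree j h) {x y} → emb c x ≡ emb c y → x ≡ y
emb-injective here    refl = refl
emb-injective (inL c) e    = emb-injective c (L-injective e)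
emb-injective (inR c) e    = emb-injective c (R-injective e)

emb-dist : ∀ {j h} (c : Subtree j h) x y → dist (emb c x) (emb c y) ≡ dist x y
emb-dist here    x y = refl
emb-dist (inL c) x y = emb-dist c x y
emb-dist (inR c) x y = emb-dist c x y

emb-depth : ∀ {j h} (c : Subtree j h) x → depth (emb c x) ≡ depth (emb c root) + depth x
emb-depth here    x = refl
emb-depth (inL c) x = cong suc (emb-depth c x)
emb-depth (inR c) x = cong suc (emb-depth c x)

ecc-≤-ecc-emb : ∀ {j h} (c : Subtree j h) x → ecc x ≤ ecc (emb c x)
ecc-≤-ecc-emb c x =
  maxList-≤ (dist x) (λ w → subst (_≤ ecc (emb c x)) (emb-dist c x w) (dist-≤-ecc (emb c x) (emb c w)))

outside-dist : ∀ {j h} (c : Subtree j h) u → Outside c u → ∀ x →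
               dist u (emb c x) ≡ dist u (emb c root) + depth x
outside-dist here    u     out x = ⊥-elim (out u refl)
outside-dist (inL c) root  out x = cong suc (emb-depth c x)
outside-dist (inL c) (L u) out x = outside-dist c u (λ y → out y ∘ cong L) x
outside-dist (inL c) (R u) out x =
  trans (cong (λ d → suc (depth u) + suc d) (emb-depth c x)) (sym (+-assoc (suc (depth u)) _ (depth x)))
outside-dist (inR c) root  out x = cong suc (emb-depth c x)
outside-dist (inR c) (R u) out x = outside-dist c u (λ y → out y ∘ cong R) x
outside-dist (inR c) (L u) out x =
  trans (cong (λ d → suc (depth u) + suc d) (emb-depth c x)) (sym (+-assoc (suc (depth u)) _ (depth x)))

outside-dist-pos : ∀ {j h} (c : Subtree j h) u → Outside c u → 0 < dist u (emb c root)
outside-dist-pos here    u     out = ⊥-elim (out u refl)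
outside-dist-pos (inL c) root  out = s≤s z≤n
outside-dist-pos (inL c) (L u) out = outside-dist-pos c u (λ y → out y ∘ cong L)
outside-dist-pos (inL c) (R u) out = s≤s z≤n
outside-dist-pos (inR c) root  out = s≤s z≤n
outside-dist-pos (inR c) (R u) out = outside-dist-pos c u (λ y → out y ∘ cong R)
outside-dist-pos (inR c) (L u) out = s≤s z≤n

outside-depth-<-dist : ∀ {j h} (c : Subtree j h) u → Outside c u → ∀ x → depth x < dist u (emb c x)
outside-depth-<-dist c u out x rewrite outside-dist c u out x =
  +-monoˡ-≤ (depth x) (outside-dist-pos c u out)

outside-equidistant : ∀ {j h} (c : Subtree j h) u → Outside c u → ∀ {x y} →
                      depth x ≡ depth y → dist u (emb c x) ≡ dist u (emb c y)
outside-equidistant c u out {x} {y} dx≡dy =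
  trans (outside-dist c u out x) (trans (cong (dist u (emb c root) +_) dx≡dy) (sym (outside-dist c u out y)))

graft : ∀ {j h} → Subtree j h → (Vtx j → ℕ) → (Vtx h → ℕ) → Vtx h → ℕ
graft here    s f         = s
graft (inL c) s f root    = f root
graft (inL c) s f (L x)   = graft c s (f ∘ L) x
graft (inL c) s f (R x)   = f (R x)
graft (inR c) s f root    = f root
graft (inR c) s f (L x)   = f (L x)
graft (inR c) s f (R x)   = graft c s (f ∘ R) x

data GraftView {j h} (c : Subtree j h) (s : Vtx j → ℕ) (f : Vtx h → ℕ) : Vtx h → Set where
  inside  : ∀ x → graft c s f (emb c x) ≡ s x → GraftView c s f (emb c x)
  outside : ∀ {u} → Outside c u → graft c s f u ≡ f u → GraftView c s f u

graftView : ∀ {j h} (c : Subtree j h) s f v → GraftView c s f v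
graftView here    s f v     = inside v refl
graftView (inL c) s f root  = outside (λ _ ()) refl
graftView (inL c) s f (R v) = outside (λ _ ()) refl
graftView (inL c) s f (L v) with graftView c s (f ∘ L) v
... | inside x eq     = inside x eq
... | outside out eq  = outside (λ { x refl → out x refl }) eq
graftView (inR c) s f root  = outside (λ _ ()) refl
graftView (inR c) s f (L v) = outside (λ _ ()) refl
graftView (inR c) s f (R v) with graftView c s (f ∘ R) v
... | inside x eq     = inside x eq
... | outside out eq  = outside (λ { x refl → out x refl }) eq

weight-graft : ∀ {j h} (c : Subtree j h) s f →
               weight (graft c s f) + weight (f ∘ emb c) ≡ weight f + weight s
weight-graft here    s f = +-comm (weight s) (weight f)
weight-graft (inL c) s f = begin
    weight (graft (inL c) s f) + weight (f ∘ L ∘ emb c)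
  ≡⟨ cong (_+ weight (f ∘ L ∘ emb c)) (weight-node (graft (inL c) s f)) ⟩
    (f root + (weight (graft c s (f ∘ L)) + weight (f ∘ R))) + weight (f ∘ L ∘ emb c)
  ≡⟨ shuffle (f root) _ (weight (f ∘ R)) _ ⟩
    (f root + weight (f ∘ R)) + (weight (graft c s (f ∘ L)) + weight (f ∘ L ∘ emb c))
  ≡⟨ cong ((f root + weight (f ∘ R)) +_) (weight-graft c s (f ∘ L)) ⟩
    (f root + weight (f ∘ R)) + (weight (f ∘ L) + weight s)
  ≡⟨ sym (shuffle (f root) (weight (f ∘ L)) (weight (f ∘ R)) (weight s)) ⟩
    (f root + (weight (f ∘ L) + weight (f ∘ R))) + weight s
  ≡⟨ cong (_+ weight s) (sym (weight-node f)) ⟩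
    weight f + weight s ∎
  where open ≡-Reasoning
        shuffle : ∀ a x b y → (a + (x + b)) + y ≡ (a + b) + (x + y)
        shuffle = solve-∀
weight-graft (inR c) s f = begin
    weight (graft (inR c) s f) + weight (f ∘ R ∘ emb c)
  ≡⟨ cong (_+ weight (f ∘ R ∘ emb c)) (weight-node (graft (inR c) s f)) ⟩
    (f root + (weight (f ∘ L) + weight (graft c s (f ∘ R)))) + weight (f ∘ R ∘ emb c)
  ≡⟨ shuffle (f root) (weight (f ∘ L)) _ _ ⟩
    (f root + weight (f ∘ L)) + (weight (graft c s (f ∘ R)) + weight (f ∘ R ∘ emb c))
  ≡⟨ cong ((f root + weight (f ∘ L)) +_) (weight-graft c s (f ∘ R)) ⟩
    (f root + weight (f ∘ L)) + (weight (f ∘ R) + weight s)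
  ≡⟨ sym (shuffle (f root) (weight (f ∘ L)) (weight (f ∘ R)) (weight s)) ⟩
    (f root + (weight (f ∘ L) + weight (f ∘ R))) + weight s
  ≡⟨ cong (_+ weight s) (sym (weight-node f)) ⟩
    weight f + weight s ∎
  where open ≡-Reasoning
        shuffle : ∀ a b x y → (a + (b + x)) + y ≡ (a + b) + (x + y)
        shuffle = solve-∀

indep-emb : ∀ {j h} (c : Subtree j h) (f : Vtx h → ℕ) → IsIndependent f → IsIndependent (f ∘ emb c)
indep-emb c f ind u v fu>0 fv>0 u≢v =
  subst (f (emb c u) <_) (emb-dist c u v) (ind _ _ fu>0 fv>0 (u≢v ∘ emb-injective c))

Compatible : ∀ {j h} → Subtree j h → (Vtx h → ℕ) → (Vtx j → ℕ) → Set
Compatible c f s = ∀ u x → Outside c u → 0 < f u → 0 < s x →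
                   f u < dist u (emb c x) × s x < dist u (emb c x)

graft-isIndepBroadcast : ∀ {j h} (c : Subtree j h) {s f} → IsIndepBroadcast f → IsIndepBroadcast s →
                         Compatible c f s → IsIndepBroadcast (graft c s f)
graft-isIndepBroadcast c {s} {f} (f-bc , f-ind) (s-bc , s-ind) compat =
  (λ v → ≤-trans (graft≤ecc v) (ecc-≤-diam v) , graft≤ecc v) , independent
  where
  graft≤ecc : ∀ v → graft c s f v ≤ ecc v
  graft≤ecc v with graftView c s f v
  ... | inside x eq    = subst (_≤ ecc (emb c x)) (sym eq) (≤-trans (proj₂ (s-bc x)) (ecc-≤-ecc-emb c x))
  ... | outside _ eq   = subst (_≤ ecc v) (sym eq) (proj₂ (f-bc v))

  independent : IsIndependent (graft c s f)
  independent u v gu>0 gv>0 u≢v with graftView c s f u | graftView c s f v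
  ... | inside x eu | inside y ev =
    subst₂ _<_ (sym eu) (sym (emb-dist c x y))
      (s-ind x y (subst (0 <_) eu gu>0) (subst (0 <_) ev gv>0) (u≢v ∘ cong (emb c)))
  ... | outside _ eu | outside _ ev =
    subst (_< dist u v) (sym eu) (f-ind u v (subst (0 <_) eu gu>0) (subst (0 <_) ev gv>0) u≢v)
  ... | inside x eu | outside out ev =
    subst₂ _<_ (sym eu) (dist-sym v (emb c x))
      (proj₂ (compat v x out (subst (0 <_) ev gv>0) (subst (0 <_) eu gu>0)))
  ... | outside out eu | inside y ev =
    subst (_< dist u (emb c y)) (sym eu)
      (proj₁ (compat u y out (subst (0 <_) eu gu>0) (subst (0 <_) ev gv>0)))

maximal-graft-weight : ∀ {j h} (c : Subtree j h) {s f} → IsMaxIndepBroadcast f → IsIndepBroadcast s →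
                       Compatible c f s → weight s ≤ weight (f ∘ emb c)
maximal-graft-weight c {s} {f} (f-ib , f-max) s-ib compat = +-cancelˡ-≤ (weight f) _ _ (begin
    weight f + weight s                          ≡⟨ sym (weight-graft c s f) ⟩
    weight (graft c s f) + weight (f ∘ emb c)    ≤⟨ +-monoˡ-≤ _ (f-max _ (graft-isIndepBroadcast c f-ib s-ib compat)) ⟩
    weight f + weight (f ∘ emb c)                ∎)
  where open ≤-Reasoning

-- Uniform broadcasts

Uniform : ∀ {j} → ℕ → ℕ → (Vtx j → ℕ) → Set
Uniform d m s = ∀ x → 0 < s x → depth x ≡ d × s x ≡ m

uniform-isBroadcast : ∀ {j d m} {s : Vtx j → ℕ} → Uniform d m s → m ≤ d + d → IsBroadcast s
uniform-isBroadcast {s = s} uni m≤2d x = ≤-trans s≤ecc (ecc-≤-diam x) , s≤ecc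
  where
  s≤ecc : s x ≤ ecc x
  s≤ecc with zero⊎pos (s x)
  ... | inj₁ sx≡0 = ≤-trans (≤-reflexive sx≡0) z≤n
  ... | inj₂ sx>0 with uni x sx>0
  ...   | refl , refl = ≤-trans m≤2d (depth+depth-≤-ecc x)

uniform-compatible : ∀ {j h m} {f : Vtx h → ℕ} {s : Vtx j → ℕ} → IsIndependent f →
                     (c : Subtree j h) (l0 : Vtx j) → depth l0 ≡ j → 0 < f (emb c l0) → Uniform j m s →
                     (∀ u → Outside c u → 0 < f u → m < dist u (emb c l0)) → Compatible c f s
uniform-compatible ind c l0 dl0 fl>0 uni m<dist u x out fu>0 sx>0 with uni x sx>0
... | dx , refl = subst (_ <_) same (ind u (emb c l0) fu>0 fl>0 (out l0))
                , subst (_ <_) same (m<dist u out fu>0)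
  where same = outside-equidistant c u out (trans dl0 (sym dx))

uniform-graft-weight : ∀ {j h m} {f : Vtx h → ℕ} → IsMaxIndepBroadcast f →
                       (c : Subtree j h) (l0 : Vtx j) → depth l0 ≡ j → 0 < f (emb c l0) →
                       (s : Vtx j → ℕ) → IsIndependent s → Uniform j m s → m ≤ j + j →
                       (∀ u → Outside c u → 0 < f u → m < dist u (emb c l0)) →
                       weight s ≤ weight (f ∘ emb c)
uniform-graft-weight mx c l0 dl0 fl>0 s s-ind uni m≤2j m<dist =
  maximal-graft-weight c mx (uniform-isBroadcast uni m≤2j , s-ind)
    (uniform-compatible (proj₂ (proj₁ mx)) c l0 dl0 fl>0 uni m<dist)

mass : ∀ {j} → Vtx j → ℕ → Vtx j → ℕ
mass root  m root  = m
mass (L a) m (L x) = mass a m x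
mass (R a) m (R x) = mass a m x
mass _     _ _     = 0

mass-at : ∀ {j} (a : Vtx j) m → mass a m a ≡ m
mass-at root  m = refl
mass-at (L a) m = mass-at a m
mass-at (R a) m = mass-at a m

mass-pos : ∀ {j} (a : Vtx j) m x → 0 < mass a m x → x ≡ a
mass-pos root  m root  _ = refl
mass-pos (L a) m (L x) p = cong L (mass-pos a m x p)
mass-pos (R a) m (R x) p = cong R (mass-pos a m x p)

weight-mass : ∀ {j} (a : Vtx j) m → weight (mass a m) ≡ m
weight-mass a m = trans (weight-supported (mass a m) a off) (mass-at a m)
  where
  off : ∀ x → x ≢ a → mass a m x ≡ 0
  off x x≢a with zero⊎pos (mass a m x)
  ... | inj₁ ≡0 = ≡0
  ... | inj₂ >0 = ⊥-elim (x≢a (mass-pos a m x >0))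

mass-uniform : ∀ {j d} (a : Vtx j) m → depth a ≡ d → Uniform d m (mass a m)
mass-uniform a m da x p with mass-pos a m x p
... | refl = da , mass-at a m

mass-independent : ∀ {j} (a : Vtx j) m → IsIndependent (mass a m)
mass-independent a m u v pu pv u≢v = ⊥-elim (u≢v (trans (mass-pos a m u pu) (sym (mass-pos a m v pv))))

<-suc+suc : ∀ {a b d n} → a ≡ d → b ≡ d → n ≤ suc (d + d) → n < suc a + suc b
<-suc+suc {d = d} refl refl n≤ = s≤s (≤-trans n≤ (≤-reflexive (sym (+-suc d d))))

branches : ∀ {j} → (Vtx j → ℕ) → (Vtx j → ℕ) → Vtx (suc j) → ℕ
branches s t root  = 0
branches s t (L x) = s x
branches s t (R x) = t x

branches-uniform : ∀ {j d m} {s t : Vtx j → ℕ} → Uniform d m s → Uniform d m t →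
                   Uniform (suc d) m (branches s t)
branches-uniform us ut (L x) p = map₁ (cong suc) (us x p)
branches-uniform us ut (R x) p = map₁ (cong suc) (ut x p)

branches-independent : ∀ {j d m} {s t : Vtx j → ℕ} → IsIndependent s → IsIndependent t →
                       Uniform d m s → Uniform d m t → m ≤ suc (d + d) → IsIndependent (branches s t)
branches-independent s-ind t-ind us ut m≤ (L x) (L y) p q ne = s-ind x y p q (ne ∘ cong L)
branches-independent s-ind t-ind us ut m≤ (R x) (R y) p q ne = t-ind x y p q (ne ∘ cong R)
branches-independent s-ind t-ind us ut m≤ (L x) (R y) p q ne with us x p | ut y q
... | dx , refl | dy , _ = <-suc+suc dx dy m≤
branches-independent s-ind t-ind us ut m≤ (R x) (L y) p q ne with ut x p | us y q
... | dx , refl | dy , _ = <-suc+suc dx dy m≤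

-- Automorphisms

swapTo : ∀ {h} → Vtx h → Vtx h → Vtx h
swapTo root  v     = v
swapTo (L x) root  = root
swapTo (L x) (L v) = L (swapTo x v)
swapTo (L x) (R v) = R (swapTo x v)
swapTo (R x) root  = root
swapTo (R x) (L v) = R (swapTo x v)
swapTo (R x) (R v) = L (swapTo x v)

swapTo-depth : ∀ {h} (x v : Vtx h) → depth (swapTo x v) ≡ depth v
swapTo-depth root  v     = refl
swapTo-depth (L x) root  = refl
swapTo-depth (L x) (L v) = cong suc (swapTo-depth x v)
swapTo-depth (L x) (R v) = cong suc (swapTo-depth x v)
swapTo-depth (R x) root  = refl
swapTo-depth (R x) (L v) = cong suc (swapTo-depth x v)
swapTo-depth (R x) (R v) = cong suc (swapTo-depth x v)

swapTo-dist : ∀ {h} (x u v : Vtx h) → dist (swapTo x u) (swapTo x v) ≡ dist u v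
swapTo-dist root  u     v     = refl
swapTo-dist (L x) root  root  = refl
swapTo-dist (L x) root  (L v) = cong suc (swapTo-depth x v)
swapTo-dist (L x) root  (R v) = cong suc (swapTo-depth x v)
swapTo-dist (L x) (L u) root  = cong suc (swapTo-depth x u)
swapTo-dist (L x) (R u) root  = cong suc (swapTo-depth x u)
swapTo-dist (L x) (L u) (L v) = swapTo-dist x u v
swapTo-dist (L x) (R u) (R v) = swapTo-dist x u v
swapTo-dist (L x) (L u) (R v) = cong₂ (λ a b → suc a + suc b) (swapTo-depth x u) (swapTo-depth x v)
swapTo-dist (L x) (R u) (L v) = cong₂ (λ a b → suc a + suc b) (swapTo-depth x u) (swapTo-depth x v)
swapTo-dist (R x) root  root  = refl
swapTo-dist (R x) root  (L v) = cong suc (swapTo-depth x v)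
swapTo-dist (R x) root  (R v) = cong suc (swapTo-depth x v)
swapTo-dist (R x) (L u) root  = cong suc (swapTo-depth x u)
swapTo-dist (R x) (R u) root  = cong suc (swapTo-depth x u)
swapTo-dist (R x) (L u) (L v) = swapTo-dist x u v
swapTo-dist (R x) (R u) (R v) = swapTo-dist x u v
swapTo-dist (R x) (L u) (R v) = cong₂ (λ a b → suc a + suc b) (swapTo-depth x u) (swapTo-depth x v)
swapTo-dist (R x) (R u) (L v) = cong₂ (λ a b → suc a + suc b) (swapTo-depth x u) (swapTo-depth x v)

swapTo-involutive : ∀ {h} (x v : Vtx h) → swapTo x (swapTo x v) ≡ v
swapTo-involutive root  v     = refl
swapTo-involutive (L x) root  = refl
swapTo-involutive (L x) (L v) = cong L (swapTo-involutive x v)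
swapTo-involutive (L x) (R v) = cong R (swapTo-involutive x v)
swapTo-involutive (R x) root  = refl
swapTo-involutive (R x) (L v) = cong L (swapTo-involutive x v)
swapTo-involutive (R x) (R v) = cong R (swapTo-involutive x v)

weight-swapTo : ∀ {h} (x : Vtx h) (φ : Vtx h → ℕ) → weight (φ ∘ swapTo x) ≡ weight φ
weight-swapTo root φ = refl
weight-swapTo (L x) φ rewrite weight-node (φ ∘ swapTo (L x)) | weight-node φ =
  cong (φ root +_) (cong₂ _+_ (weight-swapTo x (φ ∘ L)) (weight-swapTo x (φ ∘ R)))
weight-swapTo (R x) φ rewrite weight-node (φ ∘ swapTo (R x)) | weight-node φ =
  cong (φ root +_) (trans (cong₂ _+_ (weight-swapTo x (φ ∘ R)) (weight-swapTo x (φ ∘ L)))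
                          (+-comm (weight (φ ∘ R)) (weight (φ ∘ L))))

indep-swapTo : ∀ {h} (x : Vtx h) (φ : Vtx h → ℕ) → IsIndependent φ → IsIndependent (φ ∘ swapTo x)
indep-swapTo x φ ind u v pu pv u≢v =
  subst (φ (swapTo x u) <_) (swapTo-dist x u v) (ind _ _ pu pv (u≢v ∘ injective))
  where
  injective : swapTo x u ≡ swapTo x v → u ≡ v
  injective e = trans (sym (swapTo-involutive x u)) (trans (cong (swapTo x) e) (swapTo-involutive x v))

leftmost : (h : ℕ) → Vtx h
leftmost zero    = root
leftmost (suc h) = L (leftmost h)

depth-leftmost : ∀ h → depth (leftmost h) ≡ h
depth-leftmost zero    = refl
depth-leftmost (suc h) = cong suc (depth-leftmost h)

swapTo-leftmost : ∀ {h} (x : Vtx h) → IsLeaf x → swapTo x (leftmost h) ≡ x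
swapTo-leftmost root  refl = refl
swapTo-leftmost (L x) e    = cong L (swapTo-leftmost x (suc-injective e))
swapTo-leftmost (R x) e    = cong R (swapTo-leftmost x (suc-injective e))

weight-bound-at-any-leaf : ∀ {h} (P : ℕ → Set) B →
  (∀ (φ : Vtx h → ℕ) → IsIndependent φ → P (φ (leftmost h)) → weight φ ≤ B) →
  ∀ (φ : Vtx h → ℕ) → IsIndependent φ → ∀ x → IsLeaf x → P (φ x) → weight φ ≤ B
weight-bound-at-any-leaf P B bound φ ind x leaf Pφx =
  subst (_≤ B) (weight-swapTo x φ)
    (bound (φ ∘ swapTo x) (indep-swapTo x φ ind) (subst P (sym (cong φ (swapTo-leftmost x leaf))) Pφx))

-- Trees of height at most 3

silent⊎broadcasting : ∀ {h} (φ : Vtx h → ℕ) → (∀ x → φ x ≡ 0) ⊎ Σ[ x ∈ Vtx h ] 0 < φ x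
silent⊎broadcasting {zero} φ with zero⊎pos (φ root)
... | inj₁ r≡0 = inj₁ λ { root → r≡0 }
... | inj₂ r>0 = inj₂ (root , r>0)
silent⊎broadcasting {suc h} φ with zero⊎pos (φ root) | silent⊎broadcasting (φ ∘ L) | silent⊎broadcasting (φ ∘ R)
... | inj₂ r>0 | _              | _              = inj₂ (root , r>0)
... | inj₁ _   | inj₂ (x , px)  | _              = inj₂ (L x , px)
... | inj₁ _   | inj₁ _         | inj₂ (x , px)  = inj₂ (R x , px)
... | inj₁ r≡0 | inj₁ L≡0       | inj₁ R≡0       = inj₁ λ { root → r≡0 ; (L x) → L≡0 x ; (R x) → R≡0 x }

weight-cherry-mono : (ψ : Vtx 1 → ℕ) {a b c : ℕ} → ψ root ≤ a → ψ (L root) ≤ b → ψ (R root) ≤ c →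
                  weight ψ ≤ a + (b + (c + 0))
weight-cherry-mono ψ ψr ψa ψb = +-mono-≤ ψr (+-mono-≤ ψa (+-mono-≤ ψb z≤n))

weight-cherry-≤ : (ψ : Vtx 1 → ℕ) → IsIndependent ψ → ∀ {B} → 2 ≤ B → (∀ x → ψ x ≤ B) → weight ψ ≤ B
weight-cherry-≤ ψ ind {B} 2≤B ψ≤B with zero⊎pos (ψ root) | zero⊎pos (ψ (L root)) | zero⊎pos (ψ (R root))
... | inj₂ r>0 | _ | _ =
  ≤-trans (weight-cherry-mono ψ (ψ≤B root) (indep-bound ind (L root) r>0 λ ()) (indep-bound ind (R root) r>0 λ ()))
          (≤-reflexive (+-identityʳ B))
... | inj₁ r≡0 | inj₁ a≡0 | _ =
  ≤-trans (weight-cherry-mono ψ (≤-reflexive r≡0) (≤-reflexive a≡0) (ψ≤B (R root))) (≤-reflexive (+-identityʳ B))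
... | inj₁ r≡0 | inj₂ _ | inj₁ b≡0 =
  ≤-trans (weight-cherry-mono ψ (≤-reflexive r≡0) (ψ≤B (L root)) (≤-reflexive b≡0)) (≤-reflexive (+-identityʳ B))
... | inj₁ r≡0 | inj₂ a>0 | inj₂ b>0 =
  ≤-trans (weight-cherry-mono ψ (≤-reflexive r≡0) (indep-bound ind (L root) b>0 λ ()) (indep-bound ind (R root) a>0 λ ()))
          2≤B

SmallPower : ℕ → Set
SmallPower n = 0 < n × n ≤ 2

height2-small-leaf : (φ : Vtx 2 → ℕ) → IsIndependent φ → SmallPower (φ (leftmost 2)) →
                     weight φ ≤ 5
height2-small-leaf φ ind (a>0 , a≤2) = ≤-trans (≤-reflexive (weight-node φ)) (split (zero⊎pos (φ root)))
  where
  quiet : ∀ x → x ≢ leftmost 2 → φ x ≤ pred (dist x (leftmost 2))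
  quiet x = indep-bound ind x a>0

  left : weight (φ ∘ L) ≤ 2
  left = weight-cherry-≤ (φ ∘ L) (indep-emb (inL here) φ ind) ≤-refl λ
    { root     → ≤-trans (quiet (L root) λ ()) z≤n
    ; (L root) → a≤2
    ; (R root) → ≤-trans (quiet (L (R root)) λ ()) (n≤1+n 1) }

  split : φ root ≡ 0 ⊎ 0 < φ root → φ root + (weight (φ ∘ L) + weight (φ ∘ R)) ≤ 5
  split (inj₁ r≡0) = +-mono-≤ (≤-reflexive r≡0) (+-mono-≤ left
    (weight-cherry-≤ (φ ∘ R) (indep-emb (inR here) φ ind) (n≤1+n 2) λ
      { root     → ≤-trans (quiet (R root) λ ()) (n≤1+n 2)
      ; (L root) → quiet (R (L root)) λ ()
      ; (R root) → quiet (R (R root)) λ () }))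
  split (inj₂ r>0) = +-mono-≤ (quiet root λ ()) (+-mono-≤ left
    (weight-cherry-≤ (φ ∘ R) (indep-emb (inR here) φ ind) ≤-refl λ
      { root     → ≤-trans (indep-bound ind (R root) r>0 λ ()) z≤n
      ; (L root) → ≤-trans (indep-bound ind (R (L root)) r>0 λ ()) (n≤1+n 1)
      ; (R root) → ≤-trans (indep-bound ind (R (R root)) r>0 λ ()) (n≤1+n 1) }))

height2-bounded : (ψ : Vtx 2 → ℕ) → IsIndependent ψ → ψ root ≤ 3 →
                  (∀ x → ψ (L x) ≤ 5) → (∀ x → ψ (R x) ≤ 5) → weight ψ ≤ 6
height2-bounded ψ ind r≤3 ψL≤5 ψR≤5 = ≤-trans (≤-reflexive (weight-node ψ)) (split (zero⊎pos (ψ root)))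
  where
  indL = indep-emb (inL here) ψ ind
  indR = indep-emb (inR here) ψ ind

  split : ψ root ≡ 0 ⊎ 0 < ψ root → ψ root + (weight (ψ ∘ L) + weight (ψ ∘ R)) ≤ 6
  split (inj₂ r>0) with ψ root ≤? 2
  ... | yes r≤2 = +-mono-≤ r≤2 (+-mono-≤
    (weight-cherry-≤ (ψ ∘ L) indL ≤-refl λ x → ≤-trans (indep-bound ind (L x) r>0 λ ()) (m≤n⇒m≤1+n (depth-≤ x)))
    (weight-cherry-≤ (ψ ∘ R) indR ≤-refl λ x → ≤-trans (indep-bound ind (R x) r>0 λ ()) (m≤n⇒m≤1+n (depth-≤ x))))
  ... | no r≰2 = ≤-trans (+-mono-≤ r≤3 (+-mono-≤ (silent-below L λ ()) (silent-below R λ ()))) (m≤m+n 3 3)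
    where
    silent : ∀ x → x ≢ root → ψ x ≤ 0
    silent x x≢root with zero⊎pos (ψ x)
    ... | inj₁ x≡0 = ≤-reflexive x≡0
    ... | inj₂ x>0 = ⊥-elim (r≰2 (≤-trans (indep-bound ind root x>0 (x≢root ∘ sym)) (≤-trans pred[n]≤n (depth-≤ x))))
    silent-below : (side : Vtx 1 → Vtx 2) → (∀ {x} → side x ≢ root) → weight (ψ ∘ side) ≤ 0
    silent-below side side≢root = weight-cherry-mono (ψ ∘ side) (silent _ side≢root) (silent _ side≢root) (silent _ side≢root)
  split (inj₁ r≡0) with silent⊎broadcasting (ψ ∘ L) | silent⊎broadcasting (ψ ∘ R)
  ... | inj₁ L≡0 | _ = +-mono-≤ (≤-reflexive r≡0)
    (+-mono-≤ (≤-reflexive (weight-zero (ψ ∘ L) L≡0)) (≤-trans (weight-cherry-≤ (ψ ∘ R) indR (s≤s (s≤s z≤n)) ψR≤5) (n≤1+n 5)))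
  ... | inj₂ _ | inj₁ R≡0 = +-mono-≤ (≤-reflexive r≡0) (≤-trans
    (+-mono-≤ (weight-cherry-≤ (ψ ∘ L) indL (s≤s (s≤s z≤n)) ψL≤5) (≤-reflexive (weight-zero (ψ ∘ R) R≡0))) (n≤1+n 5))
  ... | inj₂ (x , Lx>0) | inj₂ (y , Ry>0) = +-mono-≤ (≤-reflexive r≡0) (+-mono-≤
    (weight-cherry-≤ (ψ ∘ L) indL (n≤1+n 2) λ z → ≤-trans (indep-bound ind (L z) Ry>0 λ ()) (+-mono-≤ (depth-≤ z) (s≤s (depth-≤ y))))
    (weight-cherry-≤ (ψ ∘ R) indR (n≤1+n 2) λ z → ≤-trans (indep-bound ind (R z) Lx>0 λ ()) (+-mono-≤ (depth-≤ z) (s≤s (depth-≤ x)))))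

height3-small-leaf : (φ : Vtx 3 → ℕ) → IsIndependent φ → SmallPower (φ (leftmost 3)) →
                     weight φ ≤ 11
height3-small-leaf φ ind (a>0 , a≤2) = ≤-trans (≤-reflexive (weight-node φ)) (split (zero⊎pos (φ root)))
  where
  quiet : ∀ x → x ≢ leftmost 3 → φ x ≤ pred (dist x (leftmost 3))
  quiet x = indep-bound ind x a>0

  left : weight (φ ∘ L) ≤ 5
  left = height2-small-leaf (φ ∘ L) (indep-emb (inL here) φ ind) (a>0 , a≤2)

  split : φ root ≡ 0 ⊎ 0 < φ root → φ root + (weight (φ ∘ L) + weight (φ ∘ R)) ≤ 11
  split (inj₁ r≡0) = +-mono-≤ (≤-reflexive r≡0) (+-mono-≤ left
    (height2-bounded (φ ∘ R) (indep-emb (inR here) φ ind) (quiet (R root) λ ())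
      (λ x → ≤-trans (quiet (R (L x)) λ ()) (+-monoˡ-≤ 3 (depth-≤ (L x))))
      (λ x → ≤-trans (quiet (R (R x)) λ ()) (+-monoˡ-≤ 3 (depth-≤ (R x))))))
  split (inj₂ r>0) = +-mono-≤ (quiet root λ ()) (+-mono-≤ left (≤-trans (≤-reflexive (weight-node (φ ∘ R)))
    (+-mono-≤ (indep-bound ind (R root) r>0 λ ()) (+-mono-≤
      (weight-cherry-≤ (φ ∘ R ∘ L) (indep-emb (inR (inL here)) φ ind) ≤-refl λ x →
         ≤-trans (indep-bound ind (R (L x)) r>0 λ ()) (s≤s (depth-≤ x)))
      (weight-cherry-≤ (φ ∘ R ∘ R) (indep-emb (inR (inR here)) φ ind) ≤-refl λ x →
         ≤-trans (indep-bound ind (R (R x)) r>0 λ ()) (s≤s (depth-≤ x)))))))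

leaf-subtree : ∀ j {h} → j ≤ h → (l : Vtx h) → IsLeaf l →
               Σ[ c ∈ Subtree j h ] Σ[ l0 ∈ Vtx j ] (l ≡ emb c l0 × IsLeaf l0)
leaf-subtree j j≤h l leaf with m≤n⇒m<n∨m≡n j≤h
leaf-subtree j j≤h l     leaf | inj₂ refl = here , l , refl , leaf
leaf-subtree j j≤h (L l) leaf | inj₁ (s≤s j≤h') with leaf-subtree j j≤h' l (suc-injective leaf)
... | c , l0 , refl , leaf0 = inL c , l0 , refl , leaf0
leaf-subtree j j≤h (R l) leaf | inj₁ (s≤s j≤h') with leaf-subtree j j≤h' l (suc-injective leaf)
... | c , l0 , refl , leaf0 = inR c , l0 , refl , leaf0

pairOfLeaves : ∀ j n → Vtx (suc j) → ℕ
pairOfLeaves j n = branches (mass (leftmost j) n) (mass (leftmost j) n)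

pairOfLeaves-uniform : ∀ j n → Uniform (suc j) n (pairOfLeaves j n)
pairOfLeaves-uniform j n = branches-uniform uni uni
  where uni = mass-uniform (leftmost j) n (depth-leftmost j)

pairOfLeaves-independent : ∀ j n → n ≤ suc (j + j) → IsIndependent (pairOfLeaves j n)
pairOfLeaves-independent j n n≤ = branches-independent ind ind uni uni n≤
  where uni = mass-uniform (leftmost j) n (depth-leftmost j)
        ind = mass-independent (leftmost j) n

weight-pairOfLeaves : ∀ j n → weight (pairOfLeaves j n) ≡ n + n
weight-pairOfLeaves j n =
  trans (weight-node (pairOfLeaves j n)) (cong₂ _+_ (weight-mass (leftmost j) n) (weight-mass (leftmost j) n))

fourLeaves : Vtx 3 → ℕ
fourLeaves = branches (pairOfLeaves 1 3) (pairOfLeaves 1 3)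

fourLeaves-uniform : Uniform 3 3 fourLeaves
fourLeaves-uniform = branches-uniform (pairOfLeaves-uniform 1 3) (pairOfLeaves-uniform 1 3)

fourLeaves-independent : IsIndependent fourLeaves
fourLeaves-independent =
  branches-independent ind ind (pairOfLeaves-uniform 1 3) (pairOfLeaves-uniform 1 3) (m≤n+m 3 2)
  where ind = pairOfLeaves-independent 1 3 ≤-refl

small-leaf-absurd : ∀ {h} → 2 ≤ h → (f : Vtx h → ℕ) → IsMaxIndepBroadcast f →
                    ∀ l → IsLeaf l → 0 < f l → f l ≤ 2 → ⊥
small-leaf-absurd {1} (s≤s ())
small-leaf-absurd {2} _ f mx l leaf fl>0 fl≤2 = <-irrefl refl (≤-trans
  (uniform-graft-weight mx here l leaf fl>0 (pairOfLeaves 1 3) (pairOfLeaves-independent 1 3 ≤-refl)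
     (pairOfLeaves-uniform 1 3) (n≤1+n 3) (λ u out → ⊥-elim (out u refl)))
  (weight-bound-at-any-leaf SmallPower 5 height2-small-leaf f (proj₂ (proj₁ mx)) l leaf (fl>0 , fl≤2)))
small-leaf-absurd {suc (suc (suc h))} _ f mx l leaf fl>0 fl≤2
  with leaf-subtree 3 (s≤s (s≤s (s≤s z≤n))) l leaf
... | c , l0 , refl , leaf0 = <-irrefl refl (≤-trans
  (uniform-graft-weight mx c l0 leaf0 fl>0 fourLeaves fourLeaves-independent fourLeaves-uniform (m≤m+n 3 3)
     (λ u out _ → subst (_< dist u (emb c l0)) leaf0 (outside-depth-<-dist c u out l0)))
  (weight-bound-at-any-leaf SmallPower 11 height3-small-leaf (f ∘ emb c) (indep-emb c f (proj₂ (proj₁ mx))) l0 leaf0 (fl>0 , fl≤2)))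

-- With j = suc i and n = 2j - 1, a power k ≥ 4 satisfies 2j ≤ k < 2n for a suitable i.
large-power-split : ∀ k → 4 ≤ k → Σ[ i ∈ ℕ ] (suc i + suc i ≤ k × k < (suc i + i) + (suc i + i))
large-power-split k 4≤k with halve (k ∸ 4)
... | i , lo , hi = suc i
  , (begin
      suc (suc i) + suc (suc i)   ≡⟨ double-suc-suc i ⟩
      4 + (i + i)                 ≤⟨ +-monoʳ-≤ 4 lo ⟩
      4 + (k ∸ 4)                 ≡⟨ m+[n∸m]≡n 4≤k ⟩
      k                           ∎)
  , (begin-strict
      k                           ≡⟨ sym (m+[n∸m]≡n 4≤k) ⟩
      4 + (k ∸ 4)                 ≤⟨ +-monoʳ-≤ 4 hi ⟩
      5 + (i + i)                 <⟨ +-monoʳ-≤ 6 (m≤m+n (i + i) (i + i)) ⟩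
      6 + ((i + i) + (i + i))     ≡⟨ double-odd i ⟩
      (suc (suc i) + suc i) + (suc (suc i) + suc i) ∎)
  where
  open ≤-Reasoning
  double-suc-suc : ∀ i → suc (suc i) + suc (suc i) ≡ 4 + (i + i)
  double-suc-suc = solve-∀
  double-odd : ∀ i → 6 + ((i + i) + (i + i)) ≡ (suc (suc i) + suc i) + (suc (suc i) + suc i)
  double-odd = solve-∀

large-leaf-absurd : ∀ {h} (f : Vtx h → ℕ) → IsMaxIndepBroadcast f → ∀ l → IsLeaf l → 4 ≤ f l → ⊥
large-leaf-absurd f mx l leaf 4≤fl with large-power-split (f l) 4≤fl
... | i , 2j≤fl , fl<2n with leaf-subtree (suc i) j≤h l leaf
  where
  j≤h = +-self-cancel-≤ (≤-trans 2j≤fl (≤-trans (proj₂ (proj₁ (proj₁ mx) l)) (ecc-≤-height+height l)))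
... | c , l0 , refl , leaf0 = <-irrefl refl (<-≤-trans fl<2n (begin
    n + n                          ≡⟨ sym (weight-pairOfLeaves i n) ⟩
    weight (pairOfLeaves i n)      ≤⟨ uniform-graft-weight mx c l0 leaf0 fl>0 (pairOfLeaves i n)
                                        (pairOfLeaves-independent i n ≤-refl) (pairOfLeaves-uniform i n)
                                        (<⇒≤ n<2j) far ⟩
    weight (f ∘ emb c)             ≡⟨ weight-supported (f ∘ emb c) l0 only-l0 ⟩
    f (emb c l0)                   ∎))
  where
  open ≤-Reasoning
  n = suc i + i
  ind = proj₂ (proj₁ mx)
  fl>0 : 0 < f (emb c l0)
  fl>0 = ≤-trans (s≤s z≤n) 4≤fl
  n<2j : n < suc i + suc i
  n<2j = s≤s (≤-reflexive (sym (+-suc i i)))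
  far : ∀ u → Outside c u → 0 < f u → n < dist u (emb c l0)
  far u out fu>0 = <-trans (<-≤-trans n<2j 2j≤fl)
    (subst (f (emb c l0) <_) (dist-sym (emb c l0) u) (ind (emb c l0) u fl>0 fu>0 (out l0 ∘ sym)))
  -- Everything in the subtree lies within distance 2j ≤ f(l) of l.
  only-l0 : ∀ x → x ≢ l0 → f (emb c x) ≡ 0
  only-l0 x x≢l0 with zero⊎pos (f (emb c x))
  ... | inj₁ fx≡0 = fx≡0
  ... | inj₂ fx>0 = ⊥-elim (<⇒≱ (ind (emb c l0) (emb c x) fl>0 fx>0 (x≢l0 ∘ sym ∘ emb-injective c)) (begin
        dist (emb c l0) (emb c x)  ≡⟨ emb-dist c l0 x ⟩
        dist l0 x                  ≤⟨ dist-≤-depth+depth l0 x ⟩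
        depth l0 + depth x         ≤⟨ +-mono-≤ (≤-reflexive leaf0) (depth-≤ x) ⟩
        suc i + suc i              ≤⟨ 2j≤fl ⟩
        f (emb c l0)               ∎))

mainTheorem14 : (h : ℕ) → 2 ≤ h → (f : Vtx h → ℕ) → IsMaxIndepBroadcast f →
                (l : Vtx h) → IsLeaf l → 0 < f l → f l ≡ 3
mainTheorem14 h 2≤h f mx l leaf fl>0 = ≤-antisym
  (≮⇒≥ λ 3<fl → large-leaf-absurd f mx l leaf 3<fl)
  (≮⇒≥ λ fl<3 → small-leaf-absurd 2≤h f mx l leaf fl>0 (≤-pred fl<3))
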